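{- Let $K(A,B)$ be a complete bipartite graph whose edges are colored blue and green. Then $K(A,B)$ satisfies (at least) one of the following: (1) $K(A,B)$ has a monochromatic spanning tree; (2) $K(A,B)$ is an $M$-type graph; (3) $K(A,B)$ is an $S_2$-type graph; (4) $K(A,B)$ is an $S_1$-type graph.
   Context: $K(A,B)$ is the complete bipartite graph with nonempty partite sets $A,B$, edges colored blue or green. $K(A,B)$ is $M$-type if there are partitions $A=A_1'\cup A_2'$, $B=B_1'\cup B_2'$ into nonempty parts with all edges $A_1'B_1'$ and $A_2'B_2'$ blue and all edges $A_1'B_2'$ and $A_2'B_1'$ green. Let $X$ be the set of vertices all of whose incident edges are blue and $Y$ the set of vertices all of whose incident edges are green; $K(A,B)$ is $S$-type if $X\neq\emptyset\neq Y$ (then $X\cup Y$ lies in one partite set). If $X\cup Y\subseteq A$, write $A_1=X$, $A_3=Y$, $A_2=A\setminus(A_1\cup A_3)$, and for a nonempty proper subset $B'\subsetneq B$ let $b(B')$ be the set of $x\in A_2$ with all edges from $x$ to $B'$ blue and all edges from $x$ to $B\setminus B'$ green. $K(A,B)$ is $S_1^*$-type if it is $S$-type, $|B|=1$, $|A_1|\geq2$, $|A_3|\geq 2$; $S_1'$-type if it is $S$-type, $|B|\geq 2$, $|A_1|\geq 2$, $|A_3|\geq 2$ and $b(B')\neq\emptyset$ for every nonempty proper $B'\subsetneq B$ (analogously with $A,B$ exchanged if $X\cup Y\subseteq B$). $S_1$-type means $S_1^*$-type or $S_1'$-type; $S_2$-type means $S$-type but not $S_1$-type. -}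

module Defs where

open import Data.Nat using (ℕ; zero; suc; _≤_)
open import Data.Fin using (Fin)
open import Data.Bool using (Bool; true; false; if_then_else_)
open import Data.Sum using (_⊎_; inj₁; inj₂)
open import Data.Product using (Σ; _×_; ∃; ∃-syntax)
open import Data.List using (List; []; _∷_; _++_; length)
open import Data.List.Relation.Unary.Unique.Propositional using (Unique)
open import Data.List.Relation.Unary.Linked using (Linked)
open import Data.Empty using (⊥)
open import Relation.Nullary using (¬_)
open import Relation.Binary.PropositionalEquality using (_≡_; _≢_)
open import Relation.Binary.Construct.Closure.ReflexiveTransitive using (Star)

data Color : Set where
  blue green : Color

-- A 2-edge-coloured complete bipartite graph K(A,B) with
-- A = Fin (suc m), B = Fin (suc n) (both nonempty).
Coloring : ℕ → ℕ → Set
Coloring m n = Fin (suc m) → Fin (suc n) → Color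

Vertex : ℕ → ℕ → Set
Vertex m n = Fin (suc m) ⊎ Fin (suc n)

EdgeSet : ℕ → ℕ → Set
EdgeSet m n = Fin (suc m) → Fin (suc n) → Bool

Adj : ∀ {m n} → EdgeSet m n → Vertex m n → Vertex m n → Set
Adj T (inj₁ a) (inj₂ b) = T a b ≡ true
Adj T (inj₂ b) (inj₁ a) = T a b ≡ true
Adj T (inj₁ _) (inj₁ _) = ⊥
Adj T (inj₂ _) (inj₂ _) = ⊥

Connected : ∀ {m n} → EdgeSet m n → Set
Connected {m} {n} T = (u v : Vertex m n) → Star (Adj T) u v

Cycle : ∀ {m n} → EdgeSet m n → Set
Cycle {m} {n} T =
  Σ (Vertex m n) λ v → Σ (List (Vertex m n)) λ vs →
    (2 ≤ length vs) × Unique (v ∷ vs) × Linked (Adj T) (v ∷ vs ++ v ∷ [])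

Acyclic : ∀ {m n} → EdgeSet m n → Set
Acyclic T = ¬ Cycle T

SpanningTree : ∀ {m n} → EdgeSet m n → Set
SpanningTree T = Connected T × Acyclic T

HasMonoSpanningTree : ∀ {m n} → Coloring m n → Set
HasMonoSpanningTree {m} {n} c =
  Σ Color λ col → Σ (EdgeSet m n) λ T →
    SpanningTree T × (∀ a b → T a b ≡ true → c a b ≡ col)

-- (2) M-type: p, q encode partitions (true = part 1, false = part 2).
MType : ∀ {m n} → Coloring m n → Set
MType {m} {n} c =
  Σ (Fin (suc m) → Bool) λ p → Σ (Fin (suc n) → Bool) λ q →
    (∃[ a ] p a ≡ true) × (∃[ a ] p a ≡ false) ×
    (∃[ b ] q b ≡ true) × (∃[ b ] q b ≡ false) ×
    (∀ a b → p a ≡ true  → q b ≡ true  → c a b ≡ blue) ×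
    (∀ a b → p a ≡ false → q b ≡ false → c a b ≡ blue) ×
    (∀ a b → p a ≡ true  → q b ≡ false → c a b ≡ green) ×
    (∀ a b → p a ≡ false → q b ≡ true  → c a b ≡ green)

AllCol : ∀ {m n} → Coloring m n → Color → Vertex m n → Set
AllCol c col (inj₁ a) = ∀ b → c a b ≡ col
AllCol c col (inj₂ b) = ∀ a → c a b ≡ col

InX : ∀ {m n} → Coloring m n → Vertex m n → Set
InX c = AllCol c blue

InY : ∀ {m n} → Coloring m n → Vertex m n → Set
InY c = AllCol c green

STypeGraph : ∀ {m n} → Coloring m n → Set
STypeGraph c = (∃ λ v → InX c v) × (∃ λ v → InY c v)

XYinA : ∀ {m n} → Coloring m n → Set
XYinA c = ∀ b → ¬ InX c (inj₂ b) × ¬ InY c (inj₂ b)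

TwoInA : ∀ {m n} → Coloring m n → Color → Set
TwoInA c col = ∃ λ a → ∃ λ a' → a ≢ a' × AllCol c col (inj₁ a) × AllCol c col (inj₁ a')

InA₂ : ∀ {m n} → Coloring m n → Fin (suc m) → Set
InA₂ c x = ¬ InX c (inj₁ x) × ¬ InY c (inj₁ x)

bNonempty : ∀ {m n} → Coloring m n → (Fin (suc n) → Bool) → Set
bNonempty c B' = ∃ λ x → InA₂ c x ×
  (∀ b → B' b ≡ true → c x b ≡ blue) × (∀ b → B' b ≡ false → c x b ≡ green)

S1StarA : ∀ {m n} → Coloring m n → Set
S1StarA {m} {n} c = STypeGraph c × XYinA c × n ≡ 0 × TwoInA c blue × TwoInA c green

S1PrimeA : ∀ {m n} → Coloring m n → Set
S1PrimeA {m} {n} c = STypeGraph c × XYinA c × 1 ≤ n × TwoInA c blue × TwoInA c green ×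
  ((B' : Fin (suc n) → Bool) → (∃ λ b → B' b ≡ true) → (∃ λ b → B' b ≡ false) →
    bNonempty c B')

transpose : ∀ {m n} → Coloring m n → Coloring n m
transpose c b a = c a b

-- S₁-type: S₁* or S₁', with X ∪ Y in A or (analogously) in B.
S1Type : ∀ {m n} → Coloring m n → Set
S1Type c = (S1StarA c ⊎ S1PrimeA c) ⊎ (S1StarA (transpose c) ⊎ S1PrimeA (transpose c))

S2Type : ∀ {m n} → Coloring m n → Set
S2Type c = STypeGraph c × ¬ S1Type c

-- Once the S-type property is decided, the S-type case is a matter of
-- deciding S₁-type, a finite question (the only non-obvious quantifier
-- ranges over subsets B' ⊆ B).  Otherwise X = ∅ or Y = ∅.  If, say, X ≠ ∅
-- and Y = ∅, a vertex of X is blue to the whole other side and every vertex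
-- has a blue edge, so blue reaches everything within two steps.  If
-- X = Y = ∅, fix a₀ ∈ A and split B by the colour of its edge to a₀; a short
-- case analysis (`BothColoursEverywhere`) either exhibits a monochromatic
-- walk of length ≤ 5 from a₀ to every vertex, or shows that the colouring
-- is M-type with A-parts "meets a₀ in blue" / "does not".
--
-- Trees come from a breadth-first search: if every vertex is reached from a
-- root within D layers of colour col, sending each vertex to a neighbour one
-- layer lower gives a parent function whose edges form a spanning tree
-- (connected through the root, acyclic because heights strictly drop
-- towards parents).
module Submission where

open import Defs
open import Data.Nat using (ℕ; zero; suc; _≤_; _<_; _≤′_; ≤′-refl; ≤′-step; z≤n; s≤s; _≤?_)
  renaming (_≟_ to _≟ℕ_)
open import Data.Nat.Properties using (≤⇒≤′; ≮⇒≥; <-trans; <-≤-trans; <-irrefl; ≤-pred; n<1+n)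
open import Data.Fin using (Fin; zero; suc)
open import Data.Fin.Properties using (any?; all?; ¬∀⟶∃¬) renaming (_≟_ to _≟ᶠ_)
open import Data.Fin.Subset.Properties using (anySubset?)
open import Data.Vec using (lookup; tabulate)
open import Data.Vec.Properties using (lookup∘tabulate)
open import Data.Sum using (_⊎_; inj₁; inj₂; swap; map₁; map₂)
open import Data.Sum.Properties using (≡-dec)
open import Data.Product using (_×_; _,_; proj₁; proj₂; ∃)
open import Data.Bool using (Bool; true; false) renaming (_≟_ to _≟ᵇ_)
open import Data.Unit using (⊤; tt)
open import Data.Empty using (⊥; ⊥-elim)
open import Data.List using (List; []; _∷_; _++_; length)
open import Data.List.Relation.Unary.Linked using (Linked; _∷_)
open import Data.List.Relation.Unary.AllPairs using (_∷_)
open import Data.List.Relation.Unary.All as All using (All; _∷_)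
open import Data.List.Relation.Unary.Any using (here; there)
open import Data.List.Relation.Unary.Unique.Propositional using (Unique)
open import Data.List.Membership.Propositional using (_∈_)
open import Relation.Binary.PropositionalEquality
  using (_≡_; _≢_; refl; sym; trans; subst; ≢-sym; _≗_)
open import Relation.Binary.Construct.Closure.ReflexiveTransitive
  using (Star; ε; _◅_; _◅◅_; reverse)
open import Relation.Nullary using (¬_; Dec; yes; no; does)
open import Relation.Nullary.Decidable
  using (_×-dec_; _⊎-dec_; _→-dec_; ¬?; dec-true; dec-false; decidable-stable)

does-true : ∀ {P : Set} (d : Dec P) → does d ≡ true → P
does-true (yes p) _ = p

does-false : ∀ {P : Set} (d : Dec P) → does d ≡ false → ¬ P
does-false (no ¬p) _ = ¬p

other : Color → Color
other blue = green
other green = blue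

other-involutive : ∀ col → other (other col) ≡ col
other-involutive blue = refl
other-involutive green = refl

≢other : ∀ col → col ≢ other col
≢other blue ()
≢other green ()

≢⇒≡other : ∀ {x col} → x ≢ col → x ≡ other col
≢⇒≡other {blue} {blue} ne = ⊥-elim (ne refl)
≢⇒≡other {blue} {green} _ = refl
≢⇒≡other {green} {blue} _ = refl
≢⇒≡other {green} {green} ne = ⊥-elim (ne refl)

≢other⇒≡ : ∀ {x col} → x ≢ other col → x ≡ col
≢other⇒≡ {blue} {blue} _ = refl
≢other⇒≡ {blue} {green} ne = ⊥-elim (ne refl)
≢other⇒≡ {green} {blue} ne = ⊥-elim (ne refl)
≢other⇒≡ {green} {green} _ = refl

_≟ᶜ_ : (x y : Color) → Dec (x ≡ y)
blue ≟ᶜ blue = yes refl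
green ≟ᶜ green = yes refl
blue ≟ᶜ green = no (λ ())
green ≟ᶜ blue = no (λ ())

ColEdge : ∀ {m n} → Coloring m n → Color → Vertex m n → Vertex m n → Set
ColEdge c col (inj₁ a) (inj₂ b) = c a b ≡ col
ColEdge c col (inj₂ b) (inj₁ a) = c a b ≡ col
ColEdge c col (inj₁ _) (inj₁ _) = ⊥
ColEdge c col (inj₂ _) (inj₂ _) = ⊥

colEdge? : ∀ {m n} (c : Coloring m n) col u v → Dec (ColEdge c col u v)
colEdge? c col (inj₁ a) (inj₂ b) = c a b ≟ᶜ col
colEdge? c col (inj₂ b) (inj₁ a) = c a b ≟ᶜ col
colEdge? c col (inj₁ _) (inj₁ _) = no (λ ())
colEdge? c col (inj₂ _) (inj₂ _) = no (λ ())

_≟ⱽ_ : ∀ {m n} (u v : Vertex m n) → Dec (u ≡ v)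
_≟ⱽ_ = ≡-dec _≟ᶠ_ _≟ᶠ_

any-vertex? : ∀ {m n} {P : Vertex m n → Set} → (∀ v → Dec (P v)) → Dec (∃ P)
any-vertex? P? with any? (λ a → P? (inj₁ a)) | any? (λ b → P? (inj₂ b))
... | yes (a , p) | _ = yes (inj₁ a , p)
... | no _ | yes (b , p) = yes (inj₂ b , p)
... | no ¬A | no ¬B = no λ { (inj₁ a , p) → ¬A (a , p) ; (inj₂ b , p) → ¬B (b , p) }

allCol? : ∀ {m n} (c : Coloring m n) col v → Dec (AllCol c col v)
allCol? c col (inj₁ a) = all? (λ b → c a b ≟ᶜ col)
allCol? c col (inj₂ b) = all? (λ a → c a b ≟ᶜ col)

edge-at-A : ∀ {m n} (c : Coloring m n) col a →
  ¬ AllCol c (other col) (inj₁ a) → ∃ λ b → c a b ≡ col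
edge-at-A c col a ¬all with ¬∀⟶∃¬ _ _ (λ b → c a b ≟ᶜ other col) ¬all
... | b , ne = b , ≢other⇒≡ ne

edge-at-B : ∀ {m n} (c : Coloring m n) col b →
  ¬ AllCol c (other col) (inj₂ b) → ∃ λ a → c a b ≡ col
edge-at-B c col b ¬all with ¬∀⟶∃¬ _ _ (λ a → c a b ≟ᶜ other col) ¬all
... | a , ne = a , ≢other⇒≡ ne

least : ∀ {P : ℕ → Set} → (∀ k → Dec (P k)) → ∀ D → P D →
  ∃ λ k → P k × (∀ j → j < k → ¬ P j)
least P? zero p = zero , p , λ _ ()
least P? (suc D) p with P? zero
... | yes p₀ = zero , p₀ , λ _ ()
... | no ¬p₀ with least (λ k → P? (suc k)) D p
...   | k , pk , below = suc k , pk , λ { zero _ → ¬p₀ ; (suc j) (s≤s j<k) → below j j<k }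

-- Along a walk that never
-- immediately returns to the vertex it came from, a step down (from a parent
-- to a child) can only be followed by further steps down; so a walk is a run
-- of steps up followed by a run of steps down.  A closed walk can be neither
-- entirely up nor entirely down (heights would drop resp. rise strictly), and
-- if it starts up and ends down, the start vertex has its parent both at the
-- second and at the second-to-last position, contradicting distinctness.

module ParentForest {V : Set} (Adj : V → V → Set) (par : V → V) (h : V → ℕ)
  (adj-sym : ∀ {x y} → Adj x y → Adj y x)
  (adj-parent : ∀ {x y} → Adj x y → par x ≡ y ⊎ par y ≡ x)
  (parent-lower : ∀ {x y} → Adj x y → par x ≡ y → h y < h x) where

  NoBacktrack : List V → Set
  NoBacktrack (x ∷ y ∷ z ∷ r) = x ≢ z × NoBacktrack (y ∷ z ∷ r)
  NoBacktrack _ = ⊤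

  EndsDown : List V → Set
  EndsDown (x ∷ y ∷ []) = par y ≡ x
  EndsDown (x ∷ y ∷ z ∷ r) = EndsDown (y ∷ z ∷ r)
  EndsDown _ = ⊥

  last : V → List V → V
  last x [] = x
  last x (y ∷ ys) = last y ys

  last-snoc : ∀ x ys z → last x (ys ++ z ∷ []) ≡ z
  last-snoc x [] z = refl
  last-snoc x (y ∷ ys) z = last-snoc y ys z

  downhill : ∀ x y r → Linked Adj (x ∷ y ∷ r) → NoBacktrack (x ∷ y ∷ r) → par y ≡ x →
    h x < h (last y r) × EndsDown (x ∷ y ∷ r)
  downhill x y [] (e ∷ _) _ down = parent-lower (adj-sym e) down , down
  downhill x y (z ∷ r) (e ∷ walk@(e′ ∷ _)) (x≢z , nb) down with adj-parent e′
  ... | inj₁ up = ⊥-elim (x≢z (trans (sym down) up))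
  ... | inj₂ down′ with downhill y z r walk nb down′
  ...   | rise , ends = <-trans (parent-lower (adj-sym e) down) rise , ends

  uphill : ∀ x y r → Linked Adj (x ∷ y ∷ r) → NoBacktrack (x ∷ y ∷ r) → par x ≡ y →
    h (last y r) < h x ⊎ EndsDown (x ∷ y ∷ r)
  uphill x y [] (e ∷ _) _ up = inj₁ (parent-lower e up)
  uphill x y (z ∷ r) (e ∷ walk@(e′ ∷ _)) (_ , nb) up with adj-parent e′
  ... | inj₂ down = inj₂ (proj₂ (downhill y z r walk nb down))
  ... | inj₁ up′ = map₁ (λ drop → <-trans drop (parent-lower e up)) (uphill y z r walk nb up′)

  endsDown-inside : ∀ x y ys z → EndsDown (x ∷ y ∷ ys ++ z ∷ []) → par z ∈ y ∷ ys
  endsDown-inside x y [] z down = here down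
  endsDown-inside x y (w ∷ ys) z down = there (endsDown-inside y w ys z down)

  closing-noBacktrack : ∀ {v} xs → All (v ≢_) xs → Unique xs → NoBacktrack (xs ++ v ∷ [])
  closing-noBacktrack [] _ _ = tt
  closing-noBacktrack (x ∷ []) _ _ = tt
  closing-noBacktrack (x ∷ y ∷ []) (v≢x ∷ _) _ = ≢-sym v≢x , tt
  closing-noBacktrack (x ∷ y ∷ z ∷ r) (_ ∷ v∉) ((_ ∷ x≢z ∷ _) ∷ u) =
    x≢z , closing-noBacktrack (y ∷ z ∷ r) v∉ u

  cycle-noBacktrack : ∀ v v₁ v₂ rest → Unique (v ∷ v₁ ∷ v₂ ∷ rest) →
    NoBacktrack (v ∷ v₁ ∷ v₂ ∷ rest ++ v ∷ [])
  cycle-noBacktrack v v₁ v₂ rest (v∉@(_ ∷ v≢v₂ ∷ _) ∷ u) =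
    v≢v₂ , closing-noBacktrack (v₁ ∷ v₂ ∷ rest) v∉ u

  acyclic : ∀ v vs → 2 ≤ length vs → Unique (v ∷ vs) → Linked Adj (v ∷ vs ++ v ∷ []) → ⊥
  acyclic v [] () _ _
  acyclic v (_ ∷ []) (s≤s ()) _ _
  acyclic v (v₁ ∷ v₂ ∷ rest) _ distinct@(_ ∷ (v₁∉ ∷ _)) walk@(e ∷ _) with adj-parent e
  ... | inj₂ down = <-irrefl refl (subst (λ w → h v < h w) (last-snoc v₁ (v₂ ∷ rest) v)
                      (proj₁ (downhill v v₁ _ walk (cycle-noBacktrack v v₁ v₂ rest distinct) down)))
  ... | inj₁ up with uphill v v₁ _ walk (cycle-noBacktrack v v₁ v₂ rest distinct) up
  ...   | inj₁ drop = <-irrefl refl (subst (λ w → h w < h v) (last-snoc v₁ (v₂ ∷ rest) v) drop)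
  ...   | inj₂ ends = All.lookup v₁∉ (subst (_∈ v₂ ∷ rest) up (endsDown-inside v₁ v₂ rest v ends)) refl

module ParentTree {m n} (c : Coloring m n) (col : Color) (r : Vertex m n)
  (h : Vertex m n → ℕ)
  (parent : ∀ v → v ≡ r ⊎ ∃ λ u → h u < h v × ColEdge c col u v) where

  par : Vertex m n → Vertex m n
  par v with parent v
  ... | inj₁ _ = v
  ... | inj₂ (u , _) = u

  par-step : ∀ v → (v ≡ r × par v ≡ v) ⊎ (h (par v) < h v × ColEdge c col (par v) v)
  par-step v with parent v
  ... | inj₁ v≡r = inj₁ (v≡r , refl)
  ... | inj₂ (u , lower , e) = inj₂ (lower , e)

  ParentLink : Fin (suc m) → Fin (suc n) → Set
  ParentLink a b = par (inj₁ a) ≡ inj₂ b ⊎ par (inj₂ b) ≡ inj₁ a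

  parentLink? : ∀ a b → Dec (ParentLink a b)
  parentLink? a b = par (inj₁ a) ≟ⱽ inj₂ b ⊎-dec par (inj₂ b) ≟ⱽ inj₁ a

  T : EdgeSet m n
  T a b = does (parentLink? a b)

  adj-sym : ∀ {x y} → Adj T x y → Adj T y x
  adj-sym {inj₁ _} {inj₂ _} e = e
  adj-sym {inj₂ _} {inj₁ _} e = e

  adj-parent : ∀ {x y} → Adj T x y → par x ≡ y ⊎ par y ≡ x
  adj-parent {inj₁ a} {inj₂ b} e = does-true (parentLink? a b) e
  adj-parent {inj₂ b} {inj₁ a} e = swap (does-true (parentLink? a b) e)

  parent-adj : ∀ {x y} → par x ≡ y → ColEdge c col y x → Adj T x y
  parent-adj {inj₁ a} {inj₂ b} p _ = dec-true (parentLink? a b) (inj₁ p)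
  parent-adj {inj₂ b} {inj₁ a} p _ = dec-true (parentLink? a b) (inj₂ p)

  no-loop : ∀ {x} → ¬ Adj T x x
  no-loop {inj₁ _} ()
  no-loop {inj₂ _} ()

  parent-edge : ∀ {x y} → Adj T x y → par x ≡ y → h y < h x × ColEdge c col y x
  parent-edge {x} e p with par-step x
  ... | inj₁ (_ , px) = ⊥-elim (no-loop (subst (Adj T x) (trans (sym p) px) e))
  ... | inj₂ step = subst (λ y → h y < h x × ColEdge c col y x) p step

  to-root : ∀ k v → h v < k → Star (Adj T) v r
  to-root (suc k) v h<k with par-step v
  ... | inj₁ (v≡r , _) = subst (λ w → Star (Adj T) w r) (sym v≡r) ε
  ... | inj₂ (lower , e) =
    parent-adj refl e ◅ to-root k (par v) (<-≤-trans lower (≤-pred h<k))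

  connected : Connected T
  connected u v = to-root _ u (n<1+n _) ◅◅ reverse adj-sym (to-root _ v (n<1+n _))

  acyclic : Acyclic T
  acyclic (v , vs , long , u , walk) =
    ParentForest.acyclic (Adj T) par h adj-sym adj-parent (λ e p → proj₁ (parent-edge e p))
      v vs long u walk

  colour : ∀ a b → T a b ≡ true → c a b ≡ col
  colour a b e with adj-parent {inj₁ a} {inj₂ b} e
  ... | inj₁ p = proj₂ (parent-edge {inj₁ a} e p)
  ... | inj₂ p = proj₂ (parent-edge {inj₂ b} e p)

  tree : HasMonoSpanningTree c
  tree = col , T , (connected , acyclic) , colour

module Layers {m n} (c : Coloring m n) (col : Color) (r : Vertex m n) where

  Reach : ℕ → Vertex m n → Set
  Reach zero v = v ≡ r
  Reach (suc k) v = Reach k v ⊎ ∃ λ u → Reach k u × ColEdge c col u v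

  reach? : ∀ k v → Dec (Reach k v)
  reach? zero v = v ≟ⱽ r
  reach? (suc k) v = reach? k v ⊎-dec any-vertex? (λ u → reach? k u ×-dec colEdge? c col u v)

  extend : ∀ {k} u {v} → Reach k u → ColEdge c col u v → Reach (suc k) v
  extend u ru e = inj₂ (u , ru , e)

  reach-mono : ∀ {j k v} → j ≤ k → Reach j v → Reach k v
  reach-mono j≤k = go (≤⇒≤′ j≤k)
    where
    go : ∀ {j k v} → j ≤′ k → Reach j v → Reach k v
    go ≤′-refl rv = rv
    go (≤′-step j≤k) rv = inj₁ (go j≤k rv)

  fill-from-A : ∀ {k} → (∀ a → Reach k (inj₁ a)) → (∀ b → ∃ λ a → c a b ≡ col) →
    ∀ v → Reach (suc k) v
  fill-from-A inA _ (inj₁ a) = inj₁ (inA a)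
  fill-from-A inA nbr (inj₂ b) = extend (inj₁ (proj₁ (nbr b))) (inA (proj₁ (nbr b))) (proj₂ (nbr b))

  fill-from-B : ∀ {k} → (∀ b → Reach k (inj₂ b)) → (∀ a → ∃ λ b → c a b ≡ col) →
    ∀ v → Reach (suc k) v
  fill-from-B inB nbr (inj₁ a) = extend (inj₂ (proj₁ (nbr a))) (inB (proj₁ (nbr a))) (proj₂ (nbr a))
  fill-from-B inB _ (inj₂ b) = inj₁ (inB b)

  spanning-tree : ∀ D → (∀ v → Reach D v) → HasMonoSpanningTree c
  spanning-tree D everywhere = ParentTree.tree c col r height parent
    where
    Lowest : Vertex m n → Set
    Lowest v = ∃ λ k → Reach k v × (∀ j → j < k → ¬ Reach j v)

    lowest : ∀ v → Lowest v
    lowest v = least (λ k → reach? k v) D (everywhere v)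

    height : Vertex m n → ℕ
    height v = proj₁ (lowest v)

    height-≤ : ∀ {j u} → Reach j u → height u ≤ j
    height-≤ {j} {u} ru = ≮⇒≥ (λ j<h → proj₂ (proj₂ (lowest u)) j j<h ru)

    from-layer : ∀ {v} (L : Lowest v) →
      v ≡ r ⊎ ∃ λ u → height u < proj₁ L × ColEdge c col u v
    from-layer (zero , at-root , _) = inj₁ at-root
    from-layer (suc j , inj₁ earlier , below) = ⊥-elim (below j (n<1+n j) earlier)
    from-layer (suc j , inj₂ (u , ru , e) , _) = inj₂ (u , s≤s (height-≤ ru) , e)

    parent : ∀ v → v ≡ r ⊎ ∃ λ u → height u < height v × ColEdge c col u v
    parent v = from-layer (lowest v)

star-tree : ∀ {m n} (c : Coloring m n) col v → AllCol c col v →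
  (∀ w → ¬ AllCol c (other col) w) → HasMonoSpanningTree c
star-tree c col (inj₁ a₀) all-col none =
  spanning-tree 2 (fill-from-B (λ b → extend (inj₁ a₀) refl (all-col b))
                               (λ a → edge-at-A c col a (none (inj₁ a))))
  where open Layers c col (inj₁ a₀)
star-tree c col (inj₂ b₀) all-col none =
  spanning-tree 2 (fill-from-A (λ a → extend (inj₂ b₀) refl (all-col a))
                               (λ b → edge-at-B c col b (none (inj₂ b))))
  where open Layers c col (inj₂ b₀)

-- Fix a₀ ∈ A.  A vertex a meets a₀ in col if they have a common neighbour
-- in colour col, and covers col if it has colour col to every b whose edge
-- to a₀ is not col.  A tree of colour col rooted at a₀ exists if
--   (A) some a meets a₀ in col and covers col, or
--   (B) every a meets a₀ in col or covers col, and some a meeting a₀ in col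
--       has colour col to some b that a₀ does not reach in col.
-- If (A) and (B) fail for both colours, the vertices meeting a₀ in blue and
-- the blue neighbours of a₀ form the parts of an M-type structure.

module BothColoursEverywhere {m n} (c : Coloring m n)
  (has-A : ∀ col a → ∃ λ b → c a b ≡ col)
  (has-B : ∀ col b → ∃ λ a → c a b ≡ col) where

  a₀ : Fin (suc m)
  a₀ = zero

  Meets : Color → Fin (suc m) → Set
  Meets col a = ∃ λ b → c a₀ b ≡ col × c a b ≡ col

  Covers : Color → Fin (suc m) → Set
  Covers col a = ∀ b → c a₀ b ≢ col → c a b ≡ col

  meets? : ∀ col a → Dec (Meets col a)
  meets? col a = any? (λ b → (c a₀ b ≟ᶜ col) ×-dec (c a b ≟ᶜ col))

  covers? : ∀ col a → Dec (Covers col a)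
  covers? col a = all? (λ b → ¬? (c a₀ b ≟ᶜ col) →-dec (c a b ≟ᶜ col))

  TreeA : Color → Set
  TreeA col = ∃ λ a → Meets col a × Covers col a

  TreeB : Color → Set
  TreeB col = ∃ λ p → ∃ λ b → Meets col p × c a₀ b ≢ col × c p b ≡ col

  treeA? : ∀ col → Dec (TreeA col)
  treeA? col = any? (λ a → meets? col a ×-dec covers? col a)

  treeB? : ∀ col → Dec (TreeB col)
  treeB? col = any? (λ p → any? (λ b → meets? col p ×-dec (¬? (c a₀ b ≟ᶜ col) ×-dec (c p b ≟ᶜ col))))

  avoid⇒covers : ∀ col {a} → ¬ Meets col a → Covers (other col) a
  avoid⇒covers col ¬meets b ne = ≢⇒≡other (λ e → ¬meets (b , ≢other⇒≡ ne , e))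

  -- Meeting a₀ in col uses a col-neighbour of a₀, to which a cover of the other colour is not col.
  meets-covers-clash : ∀ col {a} → Meets col a → ¬ Covers (other col) a
  meets-covers-clash col (b , e₀ , e) cov =
    ≢other col (trans (sym e) (cov b (λ e₀′ → ≢other col (trans (sym e₀) e₀′))))

  meets-or-covers : ∀ col → ¬ TreeA (other col) → ∀ a → Meets col a ⊎ Covers col a
  meets-or-covers col ¬treeA a with meets? col a
  ... | yes meets = inj₁ meets
  ... | no ¬meets with meets? (other col) a
  ...   | yes meets′ = ⊥-elim (¬treeA (a , meets′ , avoid⇒covers col ¬meets))
  ...   | no ¬meets′ = inj₂ (subst (λ d → Covers d a) (other-involutive col)
                                   (avoid⇒covers (other col) ¬meets′))

  module InColour (col : Color) where
    open Layers c col (inj₁ a₀)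

    reach-meeting : ∀ {a} → Meets col a → Reach 2 (inj₁ a)
    reach-meeting {a} (b , e₀ , e) = extend (inj₂ b) (extend (inj₁ a₀) refl e₀) e

    -- (A): B lies within 3 layers (via a₀ or via a), so everything within 4.
    treeA-case : TreeA col → HasMonoSpanningTree c
    treeA-case (a , meets , covers) = spanning-tree 4 (fill-from-B reach-B (has-A col))
      where
      reach-B : ∀ b → Reach 3 (inj₂ b)
      reach-B b with c a₀ b ≟ᶜ col
      ... | yes e₀ = reach-mono (s≤s z≤n) (extend (inj₁ a₀) refl e₀)
      ... | no ne = extend (inj₁ a) (reach-meeting meets) (covers b ne)

    -- (B): b lies within 3 layers via p, so A within 4 and everything within 5.
    treeB-case : (∀ a → Meets col a ⊎ Covers col a) → TreeB col → HasMonoSpanningTree c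
    treeB-case split (p , b , meets , ne , e) = spanning-tree 5 (fill-from-A reach-A (has-B col))
      where
      reach-A : ∀ a → Reach 4 (inj₁ a)
      reach-A a with split a
      ... | inj₁ meets′ = reach-mono (s≤s (s≤s z≤n)) (reach-meeting meets′)
      ... | inj₂ covers = extend (inj₂ b) (extend (inj₁ p) (reach-meeting meets) e) (covers b ne)

  open InColour using (treeA-case; treeB-case)

  m-type : ¬ TreeA blue → ¬ TreeA green → ¬ TreeB blue → ¬ TreeB green → MType c
  m-type ¬Ab ¬Ag ¬Bb ¬Bg =
    inA₁ , inB₁ ,
    (a₀ , dec-true (meets? blue a₀) (b⁺ , e⁺ , e⁺)) , (a⁻ , dec-false (meets? blue a⁻) ¬meets⁻) ,
    (b⁺ , dec-true (c a₀ b⁺ ≟ᶜ blue) e⁺) , (b⁻ , dec-false (c a₀ b⁻ ≟ᶜ blue) green≢blue) ,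
    (λ a b pa qb → inside-blue (does-true (meets? blue a) pa) (does-true (c a₀ b ≟ᶜ blue) qb)) ,
    (λ a b pa qb → outside-blue (does-false (meets? blue a) pa) (does-false (c a₀ b ≟ᶜ blue) qb)) ,
    (λ a b pa qb → inside-green (does-true (meets? blue a) pa) (does-false (c a₀ b ≟ᶜ blue) qb)) ,
    (λ a b pa qb → outside-green (does-false (meets? blue a) pa) (does-true (c a₀ b ≟ᶜ blue) qb))
    where
    inA₁ : Fin (suc m) → Bool
    inA₁ a = does (meets? blue a)

    inB₁ : Fin (suc n) → Bool
    inB₁ b = does (c a₀ b ≟ᶜ blue)

    b⁺ : Fin (suc n)
    b⁺ = proj₁ (has-A blue a₀)

    e⁺ : c a₀ b⁺ ≡ blue
    e⁺ = proj₂ (has-A blue a₀)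

    b⁻ : Fin (suc n)
    b⁻ = proj₁ (has-A green a₀)

    a⁻ : Fin (suc m)
    a⁻ = proj₁ (has-B blue b⁻)

    green≢blue : c a₀ b⁻ ≢ blue
    green≢blue e = ≢other green (trans (sym (proj₂ (has-A green a₀))) e)

    ¬meets⁻ : ¬ Meets blue a⁻
    ¬meets⁻ meets = ¬Bb (a⁻ , b⁻ , meets , green≢blue , proj₂ (has-B blue b⁻))

    inside-blue : ∀ {a b} → Meets blue a → c a₀ b ≡ blue → c a b ≡ blue
    inside-blue {a} {b} meets e₀ with meets-or-covers green ¬Ab a
    ... | inj₂ covers = ⊥-elim (meets-covers-clash blue meets covers)
    ... | inj₁ meets′ = ≢other⇒≡ (λ e → ¬Bg (a , b , meets′ , (λ g → ≢other blue (trans (sym e₀) g)) , e))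

    inside-green : ∀ {a b} → Meets blue a → c a₀ b ≢ blue → c a b ≡ green
    inside-green {a} {b} meets ne = ≢⇒≡other (λ e → ¬Bb (a , b , meets , ne , e))

    outside-blue : ∀ {a b} → ¬ Meets blue a → c a₀ b ≢ blue → c a b ≡ blue
    outside-blue {a} {b} ¬meets ne with meets-or-covers blue ¬Ag a
    ... | inj₁ meets = ⊥-elim (¬meets meets)
    ... | inj₂ covers = covers b ne

    outside-green : ∀ {a b} → ¬ Meets blue a → c a₀ b ≡ blue → c a b ≡ green
    outside-green {a} {b} ¬meets e₀ = ≢⇒≡other (λ e → ¬meets (b , e₀ , e))

  result : HasMonoSpanningTree c ⊎ MType c
  result with treeA? blue | treeA? green | treeB? blue | treeB? green
  ... | yes t | _ | _ | _ = inj₁ (treeA-case blue t)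
  ... | no _ | yes t | _ | _ = inj₁ (treeA-case green t)
  ... | no _ | no ¬Ag | yes t | _ = inj₁ (treeB-case blue (meets-or-covers blue ¬Ag) t)
  ... | no ¬Ab | no _ | no _ | yes t = inj₁ (treeB-case green (meets-or-covers green ¬Ab) t)
  ... | no ¬Ab | no ¬Ag | no ¬Bb | no ¬Bg = inj₂ (m-type ¬Ab ¬Ag ¬Bb ¬Bg)

not-S-type : ∀ {m n} (c : Coloring m n) → ¬ STypeGraph c → HasMonoSpanningTree c ⊎ MType c
not-S-type c ¬S with any-vertex? (allCol? c blue) | any-vertex? (allCol? c green)
... | yes (v , x) | _ = inj₁ (star-tree c blue v x (λ w y → ¬S ((v , x) , (w , y))))
... | no ¬X | yes (v , y) = inj₁ (star-tree c green v y (λ w x → ¬X (w , x)))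
... | no ¬X | no ¬Y = BothColoursEverywhere.result c has-A has-B
  where
  has-A : ∀ col a → ∃ λ b → c a b ≡ col
  has-A blue a = edge-at-A c blue a (λ y → ¬Y (inj₁ a , y))
  has-A green a = edge-at-A c green a (λ x → ¬X (inj₁ a , x))

  has-B : ∀ col b → ∃ λ a → c a b ≡ col
  has-B blue b = edge-at-B c blue b (λ y → ¬Y (inj₂ b , y))
  has-B green b = edge-at-B c green b (λ x → ¬X (inj₂ b , x))

all-subsets? : ∀ {k} {Q : (Fin k → Bool) → Set} →
  (∀ {f g} → f ≗ g → Q f → Q g) → (∀ f → Dec (Q f)) → Dec (∀ f → Q f)
all-subsets? resp Q? with anySubset? (λ s → ¬? (Q? (lookup s)))
... | yes (s , ¬q) = no (λ all-q → ¬q (all-q (lookup s)))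
... | no none = yes (λ f → resp (lookup∘tabulate f)
                         (decidable-stable (Q? _) (λ ¬q → none (tabulate f , ¬q))))

module DecideS₁ {m n} (c : Coloring m n) where

  Split : (Fin (suc n) → Bool) → Set
  Split B' = (∃ λ b → B' b ≡ true) → (∃ λ b → B' b ≡ false) → bNonempty c B'

  split-resp : ∀ {f g} → f ≗ g → Split f → Split g
  split-resp f≗g split (b , t) (b′ , f) with split (b , trans (f≗g b) t) (b′ , trans (f≗g b′) f)
  ... | x , mixed , bl , gr = x , mixed , (λ b e → bl b (trans (f≗g b) e)) , (λ b e → gr b (trans (f≗g b) e))

  sType? : Dec (STypeGraph c)
  sType? = any-vertex? (allCol? c blue) ×-dec any-vertex? (allCol? c green)

  xyInA? : Dec (XYinA c)
  xyInA? = all? (λ b → ¬? (allCol? c blue (inj₂ b)) ×-dec ¬? (allCol? c green (inj₂ b)))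

  twoInA? : ∀ col → Dec (TwoInA c col)
  twoInA? col = any? (λ a → any? (λ a′ →
    ¬? (a ≟ᶠ a′) ×-dec (allCol? c col (inj₁ a) ×-dec allCol? c col (inj₁ a′))))

  split? : ∀ B' → Dec (Split B')
  split? B' = any? (λ b → B' b ≟ᵇ true) →-dec (any? (λ b → B' b ≟ᵇ false) →-dec
    any? (λ x → (¬? (allCol? c blue (inj₁ x)) ×-dec ¬? (allCol? c green (inj₁ x))) ×-dec
      (all? (λ b → (B' b ≟ᵇ true) →-dec (c x b ≟ᶜ blue)) ×-dec
       all? (λ b → (B' b ≟ᵇ false) →-dec (c x b ≟ᶜ green)))))

  s1StarA? : Dec (S1StarA c)
  s1StarA? = sType? ×-dec (xyInA? ×-dec ((n ≟ℕ 0) ×-dec (twoInA? blue ×-dec twoInA? green)))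

  s1PrimeA? : Dec (S1PrimeA c)
  s1PrimeA? = sType? ×-dec (xyInA? ×-dec ((1 ≤? n) ×-dec
    (twoInA? blue ×-dec (twoInA? green ×-dec all-subsets? split-resp split?))))

s1? : ∀ {m n} (c : Coloring m n) → Dec (S1Type c)
s1? c = (s1StarA? ⊎-dec s1PrimeA?) ⊎-dec (T.s1StarA? ⊎-dec T.s1PrimeA?)
  where
  open DecideS₁ c
  module T = DecideS₁ (transpose c)

corollary5 : (m n : ℕ) (c : Coloring m n) →
    HasMonoSpanningTree c ⊎ MType c ⊎ S2Type c ⊎ S1Type c
corollary5 m n c with DecideS₁.sType? c
... | no ¬S = map₂ inj₁ (not-S-type c ¬S)
... | yes S with s1? c
...   | yes s1 = inj₂ (inj₂ (inj₂ s1))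
...   | no ¬s1 = inj₂ (inj₂ (inj₁ (S , ¬s1)))
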